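{- For every integer $n \geq 1$, the three edges of $T_n$, namely the horizontal edge $H_n=\{(a,n-1) : 0\le a\le n-1\}$, the vertical edge $V_n=\{(n-1,b): 0\le b\le n-1\}$ and the diagonal edge $D_n=\{(a,b)\in\mathbb{Z}^2 : a,b\ge 0,\ a+b=n-1\}$, lie in the same solitaire orbit, i.e. $\gamma(H_n)=\gamma(V_n)=\gamma(D_n)$.
   Context: A pattern is a finite subset $P\subset\mathbb{Z}^2$ (the set of cells carrying a $1$ in a $\{0,1\}$-configuration with finitely many $1$s). Let $T=\{(0,1),(1,1),(1,0)\}$. A solitaire (triangle) move applies to $P$ at a vector $v\in\mathbb{Z}^2$ when $|P\cap(v+T)|=2$, and replaces $P$ by $(P\setminus(v+T))\cup S$ for an arbitrary two-element subset $S\subset v+T$. The orbit $\gamma(P)$ is the set of patterns reachable from $P$ by finite sequences of solitaire moves. For $n\ge1$, $T_n=\{(a,b)\in\{0,\ldots,n-1\}^2 : a+b\geq n-1\}$. -}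

module Defs where

open import Data.Nat using (ℕ)
open import Data.Integer using (ℤ; +_; _+_; _-_; 1ℤ)
open import Data.Product using (_×_; _,_; Σ)
open import Data.Sum using (_⊎_)
open import Data.Empty using (⊥)
open import Data.List using (List; map; upTo; concatMap)
open import Data.List.Membership.Propositional using (_∈_; _∉_)
open import Relation.Binary.PropositionalEquality using (_≡_; _≢_)
open import Relation.Binary.Construct.Closure.ReflexiveTransitive using (Star)
open import Function.Bundles using (_⇔_)

Cell : Set
Cell = ℤ × ℤ

-- A pattern (finite subset of ℤ²) is represented by a finite list of cells;
-- the subset is the set of list members (order/duplicates irrelevant).
Pattern : Set
Pattern = List Cell

_≐_ : Pattern → Pattern → Set
P ≐ Q = ∀ c → (c ∈ P) ⇔ (c ∈ Q)

t₁ t₂ t₃ : Cell → Cell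
t₁ (x , y) = (x , y + 1ℤ)
t₂ (x , y) = (x + 1ℤ , y + 1ℤ)
t₃ (x , y) = (x + 1ℤ , y)

InTri : Cell → Cell → Set
InTri v c = (c ≡ t₁ v) ⊎ (c ≡ t₂ v) ⊎ (c ≡ t₃ v)

-- |P ∩ (v+T)| = 2  (exactly one of the three distinct cells is missing)
TwoIn : Pattern → Cell → Set
TwoIn P v = (t₁ v ∉ P × t₂ v ∈ P × t₃ v ∈ P)
          ⊎ (t₁ v ∈ P × t₂ v ∉ P × t₃ v ∈ P)
          ⊎ (t₁ v ∈ P × t₂ v ∈ P × t₃ v ∉ P)

-- A solitaire move at v: |P ∩ (v+T)| = 2 and Q = (P ∖ (v+T)) ∪ S for some
-- two-element S ⊆ v+T; i.e. Q agrees with P outside v+T and |Q ∩ (v+T)| = 2.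
Move : Pattern → Pattern → Set
Move P Q = Σ Cell λ v →
  TwoIn P v × TwoIn Q v ×
  (∀ c → ¬InTri v c → (c ∈ Q ⇔ c ∈ P))
  where ¬InTri : Cell → Cell → Set
        ¬InTri v c = InTri v c → ⊥

data Step : Pattern → Pattern → Set where
  move : ∀ {P Q} → Move P Q → Step P Q
  same : ∀ {P Q} → P ≐ Q → Step P Q

_∈γ_ : Pattern → Pattern → Set
Q ∈γ P = Star Step P Q

SameOrbit : Pattern → Pattern → Set
SameOrbit P Q = ∀ R → (R ∈γ P) ⇔ (R ∈γ Q)

H V D : ℕ → Pattern
H n = map (λ a → (+ a , + n - 1ℤ)) (upTo n)
V n = map (λ b → (+ n - 1ℤ , + b)) (upTo n)
D n = map (λ a → (+ a , (+ n - 1ℤ) - + a)) (upTo n)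

-- A pattern with exactly one cell in each column 0 … n − 1 is the graph of a
-- height function.  A triangle move at (x, y) lowers column x + 1 from height
-- y + 1 to y as soon as column x also has height y + 1, so a flat run of
-- columns can be lowered by one, right to left, keeping its leftmost column.
-- Starting from the horizontal edge (height n − 1 everywhere) and lowering
-- the run beyond column j for j = 0, …, n − 2 produces the diagonal edge.
-- Moves are reversible, so H and D share an orbit.  Reflection in the main
-- diagonal maps moves to moves, sends H to V and fixes D, so V and D share an
-- orbit too.
module Submission where

open import Defs
open import Data.Nat using (ℕ; _≥_)
open import Data.Product using (_×_)

open import Data.Nat using (zero; suc; _∸_; _⊓_; _<_; _≤_; _≤′_; ≤′-refl; ≤′-step; s≤s; _≟_; _≤?_)
import Data.Nat.Properties as ℕ
open import Data.Integer using (+_)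
open import Data.Integer.Properties using (m-n≡m⊖n; ⊖-≥)
open import Data.Product using (_,_; ∃-syntax; swap)
open import Data.Sum using (inj₁; inj₂)
open import Data.Empty using (⊥; ⊥-elim)
open import Data.List using (map; upTo)
open import Data.List.Properties using (map-cong-local; map-∘)
open import Data.List.Relation.Unary.All using (tabulate)
open import Data.List.Membership.Propositional using (_∈_; _∉_)
open import Data.List.Membership.Propositional.Properties using (∈-map⁺; ∈-map⁻; ∈-upTo⁺; ∈-upTo⁻)
open import Relation.Nullary using (yes; no)
open import Relation.Binary.PropositionalEquality using (_≡_; _≢_; refl; sym; trans; cong; cong₂; subst)
open import Relation.Binary.Construct.Closure.ReflexiveTransitive using (ε; _◅_; _◅◅_; reverse; gmap)
open import Function.Base using (_∘_)
open import Function.Bundles using (_⇔_; mk⇔; Equivalence)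
import Function.Properties.Equivalence as ⇔

infix 4 _⇝_

_⇝_ : Pattern → Pattern → Set
P ⇝ Q = Q ∈γ P

Step-sym : ∀ {P Q} → Step P Q → Step Q P
Step-sym (move (v , before , after , outside)) =
  move (v , after , before , λ c c∉T → ⇔.sym (outside c c∉T))
Step-sym (same P≐Q) = same (λ c → ⇔.sym (P≐Q c))

⇝-reverse : ∀ {P Q} → P ⇝ Q → Q ⇝ P
⇝-reverse = reverse Step-sym

≐⇒⇝ : ∀ {P Q} → P ≐ Q → P ⇝ Q
≐⇒⇝ P≐Q = same P≐Q ◅ ε

≡⇒⇝ : ∀ {P Q} → P ≡ Q → P ⇝ Q
≡⇒⇝ refl = ε

⇝⇒SameOrbit : ∀ {P Q} → P ⇝ Q → SameOrbit P Q
⇝⇒SameOrbit P⇝Q R = mk⇔ (⇝-reverse P⇝Q ◅◅_) (P⇝Q ◅◅_)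

swapᴾ : Pattern → Pattern
swapᴾ = map swap

∈-swapᴾ⁺ : ∀ {c P} → swap c ∈ P → c ∈ swapᴾ P
∈-swapᴾ⁺ = ∈-map⁺ swap

∈-swapᴾ⁻ : ∀ {c P} → c ∈ swapᴾ P → swap c ∈ P
∈-swapᴾ⁻ c∈ with _ , d∈ , refl ← ∈-map⁻ swap c∈ = d∈

swapᴾ-⇔ : ∀ {c P Q} → (swap c ∈ P ⇔ swap c ∈ Q) → (c ∈ swapᴾ P ⇔ c ∈ swapᴾ Q)
swapᴾ-⇔ e = mk⇔ (∈-swapᴾ⁺ ∘ to ∘ ∈-swapᴾ⁻) (∈-swapᴾ⁺ ∘ from ∘ ∈-swapᴾ⁻)
  where open Equivalence e

InTri-swap : ∀ {v c} → InTri v c → InTri (swap v) (swap c)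
InTri-swap (inj₁ refl)        = inj₂ (inj₂ refl)
InTri-swap (inj₂ (inj₁ refl)) = inj₂ (inj₁ refl)
InTri-swap (inj₂ (inj₂ refl)) = inj₁ refl

TwoIn-swap : ∀ {P v} → TwoIn P v → TwoIn (swapᴾ P) (swap v)
TwoIn-swap (inj₁ (∉₁ , ∈₂ , ∈₃)) = inj₂ (inj₂ (∈-swapᴾ⁺ ∈₃ , ∈-swapᴾ⁺ ∈₂ , ∉₁ ∘ ∈-swapᴾ⁻))
TwoIn-swap (inj₂ (inj₁ (∈₁ , ∉₂ , ∈₃))) = inj₂ (inj₁ (∈-swapᴾ⁺ ∈₃ , ∉₂ ∘ ∈-swapᴾ⁻ , ∈-swapᴾ⁺ ∈₁))
TwoIn-swap (inj₂ (inj₂ (∈₁ , ∈₂ , ∉₃))) = inj₁ (∉₃ ∘ ∈-swapᴾ⁻ , ∈-swapᴾ⁺ ∈₂ , ∈-swapᴾ⁺ ∈₁)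

Step-swap : ∀ {P Q} → Step P Q → Step (swapᴾ P) (swapᴾ Q)
Step-swap (move (v , before , after , outside)) =
  move (swap v , TwoIn-swap before , TwoIn-swap after ,
        λ c c∉T → swapᴾ-⇔ (outside (swap c) (c∉T ∘ InTri-swap)))
Step-swap (same P≐Q) = same (λ c → swapᴾ-⇔ (P≐Q (swap c)))

⇝-swap : ∀ {P Q} → P ⇝ Q → swapᴾ P ⇝ swapᴾ Q
⇝-swap = gmap swapᴾ Step-swap

graph : (ℕ → ℕ) → ℕ → Pattern
graph f n = map (λ a → + a , + f a) (upTo n)

map-upTo-cong : ∀ {A : Set} {φ ψ : ℕ → A} n → (∀ a → a < n → φ a ≡ ψ a) →
                map φ (upTo n) ≡ map ψ (upTo n)
map-upTo-cong n φ≡ψ = map-cong-local (tabulate (φ≡ψ _ ∘ ∈-upTo⁻))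

graph-cong : ∀ {f g} n → (∀ a → a < n → f a ≡ g a) → graph f n ≡ graph g n
graph-cong n f≡g = map-upTo-cong n (λ a a<n → cong (λ b → + a , + b) (f≡g a a<n))

∈-graph : ∀ {f n a b} → a < n → f a ≡ b → (+ a , + b) ∈ graph f n
∈-graph {f} a<n refl = ∈-map⁺ (λ a → + a , + f a) (∈-upTo⁺ a<n)

∈-graph⁻ : ∀ {f n c} → c ∈ graph f n → ∃[ a ] a < n × c ≡ (+ a , + f a)
∈-graph⁻ {f} c∈ with a , a∈ , refl ← ∈-map⁻ (λ a → + a , + f a) c∈ = a , ∈-upTo⁻ a∈ , refl

∈-graph⇒≡ : ∀ {f n a b} → (+ a , + b) ∈ graph f n → f a ≡ b
∈-graph⇒≡ c∈ with _ , _ , refl ← ∈-graph⁻ c∈ = refl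

∈-graph-agree : ∀ {f g n k c} → (∀ a → a ≢ k → f a ≡ g a) →
                c ∈ graph f n → c ≢ (+ k , + f k) → c ∈ graph g n
∈-graph-agree {k = k} f≡g c∈ c≢ with a , a<n , refl ← ∈-graph⁻ c∈ | a ≟ k
... | yes refl = ⊥-elim (c≢ refl)
... | no a≢k   = ∈-graph a<n (sym (f≡g a a≢k))

update : (ℕ → ℕ) → ℕ → ℕ → ℕ → ℕ
update f k y a with a ≟ k
... | yes _ = y
... | no _  = f a

update-same : ∀ f k y → update f k y k ≡ y
update-same f k y with k ≟ k
... | yes _  = refl
... | no k≢k = ⊥-elim (k≢k refl)

update-other : ∀ f {k} y {a} → a ≢ k → update f k y a ≡ f a
update-other f {k} y {a} a≢k with a ≟ k
... | yes a≡k = ⊥-elim (a≢k a≡k)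
... | no _    = refl

lowerColumn : ∀ {f n x y} → suc x < n → f x ≡ suc y → f (suc x) ≡ suc y →
              Step (graph f n) (graph (update f (suc x) y) n)
lowerColumn {f} {n} {x} {y} x+1<n fx≡ fx+1≡ =
  move (v , inj₂ (inj₂ (∈f₁ , ∈f₂ , ∉f₃)) , inj₂ (inj₁ (∈g₁ , ∉g₂ , ∈g₃)) , outside)
  where
    v = (+ x , + y)
    g = update f (suc x) y
    x<n = ℕ.<-trans (ℕ.n<1+n x) x+1<n

    t₁≡ : t₁ v ≡ (+ x , + suc y)
    t₁≡ = cong (λ b → + x , + b) (ℕ.+-comm y 1)
    t₂≡ : t₂ v ≡ (+ suc x , + suc y)
    t₂≡ = cong₂ (λ a b → + a , + b) (ℕ.+-comm x 1) (ℕ.+-comm y 1)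
    t₃≡ : t₃ v ≡ (+ suc x , + y)
    t₃≡ = cong (λ a → + a , + y) (ℕ.+-comm x 1)

    gx≡ : g x ≡ suc y
    gx≡ = trans (update-other f y (ℕ.<⇒≢ (ℕ.n<1+n x))) fx≡
    gx+1≡ : g (suc x) ≡ y
    gx+1≡ = update-same f (suc x) y

    ∈f₁ : t₁ v ∈ graph f n
    ∈f₁ = subst (_∈ graph f n) (sym t₁≡) (∈-graph x<n fx≡)
    ∈f₂ : t₂ v ∈ graph f n
    ∈f₂ = subst (_∈ graph f n) (sym t₂≡) (∈-graph x+1<n fx+1≡)
    ∉f₃ : t₃ v ∉ graph f n
    ∉f₃ t₃∈ = ℕ.1+n≢n (trans (sym fx+1≡) (∈-graph⇒≡ (subst (_∈ graph f n) t₃≡ t₃∈)))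
    ∈g₁ : t₁ v ∈ graph g n
    ∈g₁ = subst (_∈ graph g n) (sym t₁≡) (∈-graph x<n gx≡)
    ∉g₂ : t₂ v ∉ graph g n
    ∉g₂ t₂∈ = ℕ.<⇒≢ (ℕ.n<1+n y) (trans (sym gx+1≡) (∈-graph⇒≡ (subst (_∈ graph g n) t₂≡ t₂∈)))
    ∈g₃ : t₃ v ∈ graph g n
    ∈g₃ = subst (_∈ graph g n) (sym t₃≡) (∈-graph x+1<n gx+1≡)

    new-cell : (+ suc x , + g (suc x)) ≡ t₃ v
    new-cell = trans (cong (λ b → + suc x , + b) gx+1≡) (sym t₃≡)
    old-cell : (+ suc x , + f (suc x)) ≡ t₂ v
    old-cell = trans (cong (λ b → + suc x , + b) fx+1≡) (sym t₂≡)

    outside : ∀ c → (InTri v c → ⊥) → (c ∈ graph g n ⇔ c ∈ graph f n)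
    outside c c∉T = mk⇔
      (λ c∈ → ∈-graph-agree (λ a a≢ → update-other f y a≢) c∈
                (λ c≡ → c∉T (inj₂ (inj₂ (trans c≡ new-cell)))))
      (λ c∈ → ∈-graph-agree (λ a a≢ → sym (update-other f y a≢)) c∈
                (λ c≡ → c∉T (inj₂ (inj₁ (trans c≡ old-cell)))))

lowerPlateau : ∀ {f g n i k y} → i ≤′ k → k < n →
               (∀ a → i ≤ a → a ≤ k → f a ≡ suc y) →
               (∀ a → i < a → a ≤ k → g a ≡ y) →
               (∀ a → a ≤ i → g a ≡ f a) →
               (∀ a → a < n → k < a → g a ≡ f a) →
               graph f n ⇝ graph g n
lowerPlateau {f} {g} {n} {i} ≤′-refl _ _ _ left right = ≡⇒⇝ (sym (graph-cong n g≡f))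
  where
    g≡f : ∀ a → a < n → g a ≡ f a
    g≡f a a<n with a ≤? i
    ... | yes a≤i = left a a≤i
    ... | no  a≰i = right a a<n (ℕ.≰⇒> a≰i)
lowerPlateau {f} {g} {n} {i} {suc k} {y} (≤′-step i≤′k) k+1<n plateau lowered left right =
  lowerColumn k+1<n (plateau k i≤k (ℕ.n≤1+n k)) (plateau (suc k) (ℕ.m≤n⇒m≤1+n i≤k) ℕ.≤-refl)
    ◅ lowerPlateau i≤′k (ℕ.<-trans (ℕ.n<1+n k) k+1<n) plateau′ lowered′ left′ right′
  where
    i≤k = ℕ.≤′⇒≤ i≤′k
    f′ = update f (suc k) y

    plateau′ : ∀ a → i ≤ a → a ≤ k → f′ a ≡ suc y
    plateau′ a i≤a a≤k = trans (update-other f y (ℕ.<⇒≢ (s≤s a≤k))) (plateau a i≤a (ℕ.m≤n⇒m≤1+n a≤k))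
    lowered′ : ∀ a → i < a → a ≤ k → g a ≡ y
    lowered′ a i<a a≤k = lowered a i<a (ℕ.m≤n⇒m≤1+n a≤k)
    left′ : ∀ a → a ≤ i → g a ≡ f′ a
    left′ a a≤i = trans (left a a≤i) (sym (update-other f y (ℕ.<⇒≢ (s≤s (ℕ.≤-trans a≤i i≤k)))))
    right′ : ∀ a → a < n → k < a → g a ≡ f′ a
    right′ a a<n k<a with ℕ.m≤n⇒m<n∨m≡n k<a
    ... | inj₂ refl  = trans (lowered (suc k) (s≤s i≤k) ℕ.≤-refl) (sym (update-same f (suc k) y))
    ... | inj₁ k+1<a = trans (right a a<n k+1<a) (sym (update-other f y (ℕ.>⇒≢ k+1<a)))

stair : ℕ → ℕ → ℕ → ℕ
stair m j a = m ∸ (j ⊓ a)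

stair-step : ∀ {m j} → j < m → graph (stair m j) (suc m) ⇝ graph (stair m (suc j)) (suc m)
stair-step {m} {j} j<m =
  lowerPlateau (ℕ.≤⇒≤′ (ℕ.<⇒≤ j<m)) ℕ.≤-refl plateau lowered left right
  where
    plateau : ∀ a → j ≤ a → a ≤ m → stair m j a ≡ suc (m ∸ suc j)
    plateau a j≤a _ = trans (cong (m ∸_) (ℕ.m≤n⇒m⊓n≡m j≤a)) (ℕ.+-∸-assoc 1 j<m)
    lowered : ∀ a → j < a → a ≤ m → stair m (suc j) a ≡ m ∸ suc j
    lowered a j<a _ = cong (m ∸_) (ℕ.m≤n⇒m⊓n≡m j<a)
    left : ∀ a → a ≤ j → stair m (suc j) a ≡ stair m j a
    left a a≤j = cong (m ∸_) (trans (ℕ.m≥n⇒m⊓n≡n (ℕ.m≤n⇒m≤1+n a≤j)) (sym (ℕ.m≥n⇒m⊓n≡n a≤j)))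
    right : ∀ a → a < suc m → m < a → stair m (suc j) a ≡ stair m j a
    right a a<m+1 m<a = ⊥-elim (ℕ.≤⇒≯ (ℕ.≤-pred a<m+1) m<a)

stair-descent : ∀ {m j} → j ≤ m → graph (stair m 0) (suc m) ⇝ graph (stair m j) (suc m)
stair-descent {j = zero}  _   = ε
stair-descent {j = suc j} j<m = stair-descent (ℕ.<⇒≤ j<m) ◅◅ stair-step j<m

flat⇝antidiagonal : ∀ m → graph (λ _ → m) (suc m) ⇝ graph (m ∸_) (suc m)
flat⇝antidiagonal m =
  stair-descent ℕ.≤-refl
    ◅◅ ≡⇒⇝ (graph-cong (suc m) (λ a a<m+1 → cong (m ∸_) (ℕ.m≥n⇒m⊓n≡n (ℕ.≤-pred a<m+1))))

swap∈antidiagonal : ∀ {m c} → c ∈ graph (m ∸_) (suc m) → swap c ∈ graph (m ∸_) (suc m)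
swap∈antidiagonal {m} c∈ with a , a<m+1 , refl ← ∈-graph⁻ c∈ =
  ∈-graph (s≤s (ℕ.m∸n≤m m a)) (ℕ.m∸[m∸n]≡n (ℕ.≤-pred a<m+1))

swapᴾ-antidiagonal : ∀ m → swapᴾ (graph (m ∸_) (suc m)) ≐ graph (m ∸_) (suc m)
swapᴾ-antidiagonal m c = mk⇔ (swap∈antidiagonal ∘ ∈-swapᴾ⁻) (∈-swapᴾ⁺ ∘ swap∈antidiagonal)

D≡antidiagonal : ∀ m → D (suc m) ≡ graph (m ∸_) (suc m)
D≡antidiagonal m = map-upTo-cong (suc m)
  (λ a a<m+1 → cong (+ a ,_) (trans (m-n≡m⊖n m a) (⊖-≥ (ℕ.≤-pred a<m+1))))

V≡swapᴾH : ∀ n → V n ≡ swapᴾ (H n)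
V≡swapᴾH n = map-∘ (upTo n)

-- H (suc m) is the flat graph by computation: + (suc m) - 1ℤ reduces to + m.
H⇝D : ∀ m → H (suc m) ⇝ D (suc m)
H⇝D m = subst (H (suc m) ⇝_) (sym (D≡antidiagonal m)) (flat⇝antidiagonal m)

swapᴾ-D : ∀ m → swapᴾ (D (suc m)) ≐ D (suc m)
swapᴾ-D m = subst (λ P → swapᴾ P ≐ P) (sym (D≡antidiagonal m)) (swapᴾ-antidiagonal m)

V⇝D : ∀ m → V (suc m) ⇝ D (suc m)
V⇝D m = subst (_⇝ D (suc m)) (sym (V≡swapᴾH (suc m)))
          (⇝-swap (H⇝D m) ◅◅ ≐⇒⇝ (swapᴾ-D m))

proposition1 : (n : ℕ) → n ≥ 1 → SameOrbit (H n) (V n) × SameOrbit (V n) (D n)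
proposition1 (suc m) _ =
  ⇝⇒SameOrbit (H⇝D m ◅◅ ⇝-reverse (V⇝D m)) , ⇝⇒SameOrbit (V⇝D m)
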